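{- Let $G$ be an undirected graph and $k,\ell,r\in\mathbb{N}$ with $\ell,r\le k-1$. Let $\mathsf{conf}=(v_1,\dots,v_k)$, $\mathsf{conf}'=(v'_1,\dots,v'_k)$ and $\mathsf{conf}''=(v''_1,\dots,v''_k)$ be $(G,k)$-configurations such that $(\mathsf{conf},\mathsf{conf}')$ is an $\ell$-transition and $(\mathsf{conf}',\mathsf{conf}'')$ is an $r$-transition. Let $W$ be the triplet order of $(\mathsf{conf},\mathsf{conf}',\mathsf{conf}'')$ and let $\mathcal{G}$ be a $(V(G),3k-2)$-permuter. Then there exists $f\in\mathcal{G}$ such that: (i) $f$ maps $W$ to an ordered set of consecutive integers $(i,i+1,\dots,j)$ with $1\le i\le j\le 3k-2$ and $j-i+1=|W|$, and $f(v'_a)=2k-a$ for every $1\le a\le k$; (ii) all vertices in $W$ have pairwise different images under $f$; (iii) if there exists a configuration $\mathsf{conf}^*=(w_1=v'_1,w_2,\dots,w_k=v'_k)$ such that (1) $f(w_a)=2k-a$ for every $1\le a\le k$, (2) $w_a=v_{a-\ell}$ for every $\ell+1\le a\le k$, and (3) $v''_a=w_{a-r}$ for every $r+1\le a\le k$, then $(\mathsf{conf},\mathsf{conf}^*)$ is an $\ell$-transition and $(\mathsf{conf}^*,\mathsf{conf}'')$ is an $r$-transition.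
   Context: $[t]=\{1,\dots,t\}$. For an undirected graph $G$ and $k\in\mathbb{N}$, a $(G,k)$-configuration is a tuple $(v_1,\dots,v_k)$ of pairwise distinct vertices with $\{v_i,v_{i+1}\}\in E(G)$ for $1\le i\le k-1$. A pair $((v_1,\dots,v_k),(v'_1,\dots,v'_k))$ of configurations is a $1$-transition if $v'_1\ne v_i$ for $1\le i\le k-1$ and $v'_i=v_{i-1}$ for $2\le i\le k$; it is an $\ell$-transition if there is a sequence of $\ell+1$ configurations from the first to the second with each consecutive pair a $1$-transition. For a set $S$ of size $n$ and $t\in\mathbb{N}$, an $(S,t)$-permuter is a family $\mathcal{G}$ of functions $S\to[t]$ such that for every ordered set $W=(w_1,\dots,w_m)$ of distinct elements of $S$ with $m\le t$ and any $i\le j\le t$ with $j-i+1=m$, some $g\in\mathcal{G}$ satisfies $g(w_a)=i+a-1$ for all $a$. Triplet order: given configurations $\mathsf{conf}=(v_1,\dots,v_k)$, $\mathsf{conf}'=(v'_1,\dots,v'_k)$, $\mathsf{conf}''=(v''_1,\dots,v''_k)$, let $S$ be the ordered multiset $(v_k,v_{k-1},\dots,v_1,v'_k,\dots,v'_1,v''_k,\dots,v''_1)$. The triplet order of $(\mathsf{conf},\mathsf{conf}',\mathsf{conf}'')$ is the ordered set obtained from $S$ by first removing the entries coming from $\mathsf{conf}$ and $\mathsf{conf}''$ whose vertices are vertices of $\mathsf{conf}'$, and then removing the entries coming from $\mathsf{conf}$ whose vertices are vertices of $\mathsf{conf}''$. -}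

module Defs where

open import Data.Nat using (ℕ; zero; suc; _+_; _*_; _∸_; _≤_; _<_)
open import Data.Fin using (Fin; toℕ)
open import Data.Fin.Properties using (_≟_)
open import Data.Vec using (Vec; lookup; toList)
open import Data.List using (List; length; filter; reverse; _++_)
import Data.List as List
open import Data.List.Membership.Propositional using (_∈_)
import Data.List.Membership.DecPropositional as DecMem
open import Data.Product using (_×_; Σ; ∃; ∃-syntax; _,_)
open import Relation.Nullary using (¬_)
open import Relation.Nullary.Decidable using (¬?; _×-dec_)
open import Relation.Binary.PropositionalEquality using (_≡_; _≢_)

record Graph : Set₁ where
  field
    n   : ℕ
    Adj : Fin n → Fin n → Set
    sym : ∀ {x y} → Adj x y → Adj y x

open Graph public

-- Configurations are vectors of length k; position a (1-based) of the
-- paper is the Fin k index i with toℕ i + 1 = a.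

IsConf : (G : Graph) (k : ℕ) → Vec (Fin (n G)) k → Set
IsConf G k c =
  (∀ (i j : Fin k) → lookup c i ≡ lookup c j → i ≡ j) ×
  (∀ (i j : Fin k) → toℕ j ≡ suc (toℕ i) → Adj G (lookup c i) (lookup c j))

Trans1 : (G : Graph) (k : ℕ) → Vec (Fin (n G)) k → Vec (Fin (n G)) k → Set
Trans1 G k c c' =
  IsConf G k c × IsConf G k c' ×
  (∀ (z i : Fin k) → toℕ z ≡ 0 → suc (toℕ i) < k → lookup c' z ≢ lookup c i) ×
  (∀ (i j : Fin k) → toℕ j ≡ suc (toℕ i) → lookup c' j ≡ lookup c i)

data Trans (G : Graph) (k : ℕ) : ℕ → Vec (Fin (n G)) k → Vec (Fin (n G)) k → Set where
  done : ∀ {c} → IsConf G k c → Trans G k 0 c c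
  step : ∀ {ℓ c c' c''} → Trans1 G k c c' → Trans G k ℓ c' c'' → Trans G k (suc ℓ) c c''

IsPermuter : (G : Graph) (t : ℕ) → List (Fin (n G) → ℕ) → Set
IsPermuter G t 𝒢 =
  (∀ g → g ∈ 𝒢 → ∀ x → 1 ≤ g x × g x ≤ t) ×
  (∀ (W : List (Fin (n G))) →
     (∀ (p q : Fin (length W)) → List.lookup W p ≡ List.lookup W q → p ≡ q) →
     ∀ (i j : ℕ) → 1 ≤ i → i ≤ j → j ≤ t → suc j ≡ i + length W →
     ∃[ g ] (g ∈ 𝒢 × (∀ (p : Fin (length W)) → g (List.lookup W p) ≡ i + toℕ p)))

tripletOrder : ∀ {m k} → Vec (Fin m) k → Vec (Fin m) k → Vec (Fin m) k → List (Fin m)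
tripletOrder {m} c c' c'' =
  filter (λ x → ¬? (x ∈? toList c') ×-dec ¬? (x ∈? toList c'')) (reverse (toList c))
  ++ reverse (toList c')
  ++ filter (λ x → ¬? (x ∈? toList c')) (reverse (toList c''))
  where open DecMem (_≟_ {m}) using (_∈?_)

module Submission where

-- Write W = front ++ middle ++ back for the triplet order, where
-- middle is conf' reversed.  The three blocks are pairwise disjoint, so W is an
-- ordered set, and |front|, |back| < k because conf_1 and conf'_1 survive into
-- conf' and conf'' respectively.  Hence W can be placed on the window of [3k-2]
-- starting at k - |front|; the permuter supplies f doing so, which puts middle on
-- k, …, 2k-1, i.e. f(v'_a) = 2k-a.  This gives (i) and (ii).  For (iii) we first
-- characterise ℓ-transitions (ℓ < k) by two pointwise conditions, Shift ("the
-- configuration moved ℓ places") and Fresh ("the ℓ entering vertices were new"),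
-- and observe that f is injective on the vertices of W, which contain all
-- vertices of conf, conf', conf''.  A candidate conf* with f(w_a) = f(v'_a) then
-- inherits freshness from conf': any collision w_a = v_b is a collision
-- v'_a = v_b.  Shift is assumed, so conf* is reached by the same transitions.

open import Defs hiding (sym)
open import Data.Nat using (ℕ; zero; suc; _+_; _*_; _∸_; _≤_; _<_; z≤n; s≤s; s≤s⁻¹)
open import Data.Nat.Properties
open import Data.Fin using (Fin; toℕ; fromℕ<; inject₁; zero; suc)
open import Data.Fin.Properties using (toℕ-injective; toℕ-fromℕ<; toℕ-inject₁; inject₁-injective; toℕ<n)
import Data.Fin.Properties as Fin
open import Data.Vec using (Vec; lookup; tabulate; _∷_; []; toList)
open import Data.Vec.Properties using (lookup∘tabulate; tabulate∘lookup; tabulate-cong; length-toList)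
open import Data.Vec.Membership.Propositional.Properties using (∈-toList⁺; ∈-toList⁻) renaming (∈-lookup to ∈-lookupᵥ)
import Data.Vec.Relation.Unary.Any as VecAny
import Data.Vec.Relation.Unary.Any.Properties as VecAnyP
open import Data.List using (List; length; filter; reverse; _++_)
import Data.List as List
open import Data.List.Properties using (unfold-reverse; length-reverse; filter-notAll; length-++)
open import Data.List.Membership.Propositional using (_∈_; lose)
open import Data.List.Membership.Propositional.Properties using (∈-filter⁺; ∈-filter⁻; ∈-++⁺ˡ; ∈-++⁺ʳ; ∈-++⁻; ∈-lookup)
import Data.List.Membership.DecPropositional as DecMem
open import Data.List.Relation.Unary.Any using (here; index)
open import Data.List.Relation.Unary.Any.Properties using (lookup-index; reverse⁺; reverse⁻)
import Data.List.Relation.Unary.All as All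
open import Data.List.Relation.Unary.AllPairs using ([]; _∷_)
open import Data.List.Relation.Unary.Unique.Propositional using (Unique)
import Data.List.Relation.Unary.Unique.Propositional.Properties as Unique
open import Data.List.Relation.Binary.Disjoint.Propositional using (Disjoint)
open import Data.Product using (_×_; ∃-syntax; _,_; proj₁; proj₂)
open import Data.Sum using (_⊎_; inj₁; inj₂; [_,_]′; map₂)
open import Data.Empty using (⊥; ⊥-elim)
open import Relation.Nullary using (¬_; Dec; yes; no)
open import Relation.Nullary.Decidable using (¬?; _×-dec_)
open import Relation.Binary.PropositionalEquality

Shift : ∀ {A : Set} {k} → ℕ → Vec A k → Vec A k → Set
Shift {k = k} ℓ c d = ∀ (a b : Fin k) → toℕ a ≡ toℕ b + ℓ → lookup d a ≡ lookup c b

-- The vertex d_a (a < ℓ) entered at step ℓ - a; it differs from every c_b still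
-- present at that moment, i.e. every b with b + ℓ < k + a.
Fresh : ∀ {A : Set} {k} → ℕ → Vec A k → Vec A k → Set
Fresh {k = k} ℓ c d =
  ∀ (a b : Fin k) → toℕ a < ℓ → toℕ b + ℓ < k + toℕ a → lookup d a ≢ lookup c b

shift-zero : ∀ {A : Set} {k} {c d : Vec A k} → Shift 0 c d → c ≡ d
shift-zero {c = c} {d} sh = begin
  c                    ≡⟨ tabulate∘lookup c ⟨
  tabulate (lookup c)  ≡⟨ tabulate-cong (λ a → sym (sh a a (sym (+-identityʳ (toℕ a))))) ⟩
  tabulate (lookup d)  ≡⟨ tabulate∘lookup d ⟩
  d                    ∎
  where open ≡-Reasoning

shift-compose : ∀ {A : Set} {k m ℓ} {c e d : Vec A k} →
  Shift m c e → Shift ℓ e d → Shift (m + ℓ) c d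
shift-compose {k = k} {m} {ℓ} sce sed a b a≡ =
  trans (sed a x (trans a≡ (trans (sym (+-assoc (toℕ b) m ℓ)) (cong (_+ ℓ) (sym (toℕ-fromℕ< x<k))))))
        (sce x b (toℕ-fromℕ< x<k))
  where
  x<k : toℕ b + m < k
  x<k = begin-strict
    toℕ b + m        ≤⟨ m≤m+n (toℕ b + m) ℓ ⟩
    toℕ b + m + ℓ    ≡⟨ +-assoc (toℕ b) m ℓ ⟩
    toℕ b + (m + ℓ)  ≡⟨ a≡ ⟨
    toℕ a            <⟨ toℕ<n a ⟩
    k                ∎
    where open ≤-Reasoning
  x : Fin k
  x = fromℕ< x<k

trans1-shift : ∀ {G k} {c e : Vec (Fin (n G)) k} → Trans1 G k c e → Shift 1 c e
trans1-shift (_ , _ , _ , moves) a b a≡b+1 = moves b a (trans a≡b+1 (+-comm (toℕ b) 1))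

-- Freshness after one more 1-transition in front: a vertex of d entered either
-- in a later step (freshness of (e, d)) or in the first one, as the first
-- vertex of e.
fresh-step : ∀ {G k ℓ} {c e d : Vec (Fin (n G)) k} →
  Trans1 G k c e → Shift ℓ e d → Fresh ℓ e d → Fresh (suc ℓ) c d
fresh-step {k = k} {ℓ} {c} {e} {d} (_ , _ , entry , moves) sed fed a b a≤ℓ room eq =
  [ entered-later , entered-first ]′ (m≤n⇒m<n∨m≡n (s≤s⁻¹ a≤ℓ))
  where
  b+1<k : suc (toℕ b) < k
  b+1<k = +-cancelʳ-< ℓ (suc (toℕ b)) k (begin-strict
    suc (toℕ b) + ℓ  ≡⟨ +-suc (toℕ b) ℓ ⟨
    toℕ b + suc ℓ    <⟨ room ⟩
    k + toℕ a        ≤⟨ +-monoʳ-≤ k (s≤s⁻¹ a≤ℓ) ⟩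
    k + ℓ            ∎)
    where open ≤-Reasoning
  b+1 : Fin k
  b+1 = fromℕ< b+1<k
  -- d_a = c_b = e_{b+1}, forbidden by freshness of (e, d).
  entered-later : toℕ a < ℓ → ⊥
  entered-later a<ℓ = fed a b+1 a<ℓ room′ (trans eq (sym (moves b b+1 (toℕ-fromℕ< b+1<k))))
    where
    room′ : toℕ b+1 + ℓ < k + toℕ a
    room′ = subst (λ x → x + ℓ < k + toℕ a) (sym (toℕ-fromℕ< b+1<k))
                  (subst (_< k + toℕ a) (+-suc (toℕ b) ℓ) room)
  -- d_a is the first vertex of e and equals c_b, forbidden by the 1-transition.
  entered-first : toℕ a ≡ ℓ → ⊥
  entered-first a≡ℓ =
    entry first b (toℕ-fromℕ< 0<k) b+1<k
      (trans (sym (sed a first (trans a≡ℓ (cong (_+ ℓ) (sym (toℕ-fromℕ< 0<k)))))) eq)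
    where
    0<k : 0 < k
    0<k = ≤-<-trans z≤n (toℕ<n b)
    first : Fin k
    first = fromℕ< 0<k

transition⇒shift-fresh : ∀ {G k ℓ} {c d : Vec (Fin (n G)) k} →
  Trans G k ℓ c d → Shift ℓ c d × Fresh ℓ c d
transition⇒shift-fresh {c = c} (done _) =
  (λ a b a≡b+0 → cong (lookup c) (toℕ-injective (trans a≡b+0 (+-identityʳ _)))) , (λ _ _ ())
transition⇒shift-fresh {G} {c = c} {d} (step {c' = e} t ts) =
  let (sed , fed) = transition⇒shift-fresh ts
  in  shift-compose {c = c} {e} {d} (trans1-shift {G} {c = c} {e} t) sed , fresh-step {G} {c = c} {e} {d} t sed fed

-- Conversely, for c, d related by a fresh shift by l+1 < k we construct the
-- configuration `next` one 1-transition after c, which is related to d by a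
-- fresh shift by l: it is c moved one place, entered by d_{l+1}.
module OneStepTowards {G : Graph} {k' l : ℕ} {c d : Vec (Fin (n G)) (suc k')}
  (l+1<k : suc l < suc k') (cc : IsConf G (suc k') c) (cd : IsConf G (suc k') d)
  (sh : Shift (suc l) c d) (fr : Fresh (suc l) c d) where

  l<k : l < suc k'
  l<k = <-trans (n<1+n l) l+1<k

  entering : Fin (n G)
  entering = lookup d (fromℕ< l<k)

  next : Vec (Fin (n G)) (suc k')
  next = entering ∷ tabulate (λ i → lookup c (inject₁ i))

  next-suc : ∀ i → lookup next (suc i) ≡ lookup c (inject₁ i)
  next-suc = lookup∘tabulate (λ i → lookup c (inject₁ i))

  survives : ∀ (i : Fin k') → suc (toℕ (inject₁ i)) < suc k'
  survives i = s≤s (subst (_< k') (sym (toℕ-inject₁ i)) (toℕ<n i))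

  entering-new : ∀ (b : Fin (suc k')) → suc (toℕ b) < suc k' → entering ≢ lookup c b
  entering-new b b+1<k =
    fr (fromℕ< l<k) b (subst (_< suc l) (sym (toℕ-fromℕ< l<k)) (n<1+n l)) (begin-strict
      toℕ b + suc l                 ≡⟨ +-suc (toℕ b) l ⟩
      suc (toℕ b) + l               <⟨ +-monoˡ-< l b+1<k ⟩
      suc k' + l                    ≡⟨ cong (suc k' +_) (toℕ-fromℕ< l<k) ⟨
      suc k' + toℕ (fromℕ< l<k)     ∎)
    where open ≤-Reasoning

  next-injective : ∀ i j → lookup next i ≡ lookup next j → i ≡ j
  next-injective zero    zero    _  = refl
  next-injective zero    (suc j) eq = ⊥-elim (entering-new (inject₁ j) (survives j) (trans eq (next-suc j)))
  next-injective (suc i) zero    eq = ⊥-elim (entering-new (inject₁ i) (survives i) (trans (sym eq) (next-suc i)))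
  next-injective (suc i) (suc j) eq =
    cong suc (inject₁-injective (proj₁ cc _ _ (trans (sym (next-suc i)) (trans eq (next-suc j)))))

  -- next is a configuration: its first vertex d_l is adjacent to d_{l+1}, which is
  -- c_0, its second vertex; the remaining adjacencies are those of c.
  next-adjacent : ∀ (i j : Fin (suc k')) → toℕ j ≡ suc (toℕ i) → Adj G (lookup next i) (lookup next j)
  next-adjacent zero    zero    ()
  next-adjacent (suc i) zero    ()
  next-adjacent zero    (suc j) j≡1 =
    subst (Adj G entering) (trans d≡c (sym (next-suc j)))
      (proj₂ cd (fromℕ< l<k) (fromℕ< l+1<k) (trans (toℕ-fromℕ< l+1<k) (cong suc (sym (toℕ-fromℕ< l<k)))))
    where
    d≡c : lookup d (fromℕ< l+1<k) ≡ lookup c (inject₁ j)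
    d≡c = sh _ (inject₁ j)
      (trans (toℕ-fromℕ< l+1<k) (cong (_+ suc l) (sym (trans (toℕ-inject₁ j) (suc-injective j≡1)))))
  next-adjacent (suc i) (suc j) j≡i+1 =
    subst₂ (Adj G) (sym (next-suc i)) (sym (next-suc j))
      (proj₂ cc (inject₁ i) (inject₁ j)
        (trans (toℕ-inject₁ j) (trans (suc-injective j≡i+1) (cong suc (sym (toℕ-inject₁ i))))))

  next-isConf : IsConf G (suc k') next
  next-isConf = next-injective , next-adjacent

  next-step : Trans1 G (suc k') c next
  next-step = cc , next-isConf , entry , moves
    where
    entry : ∀ (z i : Fin (suc k')) → toℕ z ≡ 0 → suc (toℕ i) < suc k' → lookup next z ≢ lookup c i
    entry zero    i _ = entering-new i
    entry (suc z) i ()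
    moves : ∀ (i j : Fin (suc k')) → toℕ j ≡ suc (toℕ i) → lookup next j ≡ lookup c i
    moves i zero    ()
    moves i (suc j) j≡i+1 =
      trans (next-suc j) (cong (lookup c) (toℕ-injective (trans (toℕ-inject₁ j) (suc-injective j≡i+1))))

  next-shift : Shift l next d
  next-shift a zero    a≡l   = cong (lookup d) (toℕ-injective (trans a≡l (sym (toℕ-fromℕ< l<k))))
  next-shift a (suc b) a≡b+l = trans (sh a (inject₁ b) a≡) (sym (next-suc b))
    where
    a≡ : toℕ a ≡ toℕ (inject₁ b) + suc l
    a≡ = trans a≡b+l (trans (sym (+-suc (toℕ b) l)) (cong (_+ suc l) (sym (toℕ-inject₁ b))))

  next-fresh : Fresh l next d
  next-fresh a zero    a<l _    eq = <-irrefl (trans (cong toℕ (proj₁ cd _ _ eq)) (toℕ-fromℕ< l<k)) a<l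
  next-fresh a (suc b) a<l room eq = fr a (inject₁ b) (m<n⇒m<1+n a<l) room′ (trans eq (next-suc b))
    where
    room′ : toℕ (inject₁ b) + suc l < suc k' + toℕ a
    room′ = subst (λ x → x + suc l < suc k' + toℕ a) (sym (toℕ-inject₁ b))
                  (subst (_< suc k' + toℕ a) (sym (+-suc (toℕ b) l)) room)

shift-fresh⇒transition : ∀ {G k ℓ} {c d : Vec (Fin (n G)) k} → ℓ < k →
  IsConf G k c → IsConf G k d → Shift ℓ c d → Fresh ℓ c d → Trans G k ℓ c d
shift-fresh⇒transition {G} {ℓ = zero} {c} _ cc _ sh _ = subst (Trans G _ 0 c) (shift-zero sh) (done cc)
shift-fresh⇒transition {G} {suc k'} {suc l} {c} {d} l+1<k cc cd sh fr =
  step {c' = next} next-step (shift-fresh⇒transition {c = next} {d} l<k next-isConf cd next-shift next-fresh)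
  where open OneStepTowards {G} {c = c} {d} l+1<k cc cd sh fr

first-survives : ∀ {A : Set} {k' ℓ} {c d : Vec A (suc k')} → ℓ < suc k' → Shift ℓ c d →
  lookup c zero ∈ toList d
first-survives {d = d} ℓ<k sh =
  subst (_∈ toList d) (sh (fromℕ< ℓ<k) zero (toℕ-fromℕ< ℓ<k)) (∈-toList⁺ (∈-lookupᵥ (fromℕ< ℓ<k) d))

Window : ∀ {A : Set} → (A → ℕ) → ℕ → List A → Set
Window f s L = ∀ (p : Fin (length L)) → f (List.lookup L p) ≡ s + toℕ p

window-tail : ∀ {A : Set} {f : A → ℕ} {s x} {L : List A} → Window f s (x List.∷ L) → Window f (suc s) L
window-tail {s = s} w p = trans (w (suc p)) (+-suc s (toℕ p))

window-++ : ∀ {A : Set} {f : A → ℕ} {s} (X : List A) {Y : List A} →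
  Window f s (X ++ Y) → Window f s X × Window f (s + length X) Y
window-++ {f = f} {s} List.[] {Y} w = (λ ()) , subst (λ t → Window f t Y) (sym (+-identityʳ s)) w
window-++ {f = f} {s} (x List.∷ X) {Y} w =
  let (wX , wY) = window-++ {f = f} {suc s} X {Y} (window-tail {f = f} {s} {x} {X ++ Y} w)
  in  head-and-tail wX , subst (λ t → Window f t Y) (sym (+-suc s (length X))) wY
  where
  head-and-tail : Window f (suc s) X → Window f s (x List.∷ X)
  head-and-tail wX zero    = w zero
  head-and-tail wX (suc p) = trans (wX p) (sym (+-suc s (toℕ p)))

window-distinct : ∀ {A : Set} {f : A → ℕ} {s} {L : List A} → Window f s L →
  ∀ (p q : Fin (length L)) → p ≢ q → f (List.lookup L p) ≢ f (List.lookup L q)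
window-distinct {s = s} w p q p≢q fp≡fq =
  p≢q (toℕ-injective (+-cancelˡ-≡ s _ _ (trans (sym (w p)) (trans fp≡fq (w q)))))

window-injective : ∀ {A : Set} {f : A → ℕ} {s} {L : List A} {x y} → Window f s L →
  x ∈ L → y ∈ L → f x ≡ f y → x ≡ y
window-injective {f = f} {s} {L} {x} {y} w x∈ y∈ fx≡fy = begin
  x                        ≡⟨ lookup-index x∈ ⟩
  List.lookup L (index x∈) ≡⟨ cong (List.lookup L) same-position ⟩
  List.lookup L (index y∈) ≡⟨ lookup-index y∈ ⟨
  y                        ∎
  where
  open ≡-Reasoning
  same-position : index x∈ ≡ index y∈
  same-position = toℕ-injective (+-cancelˡ-≡ s _ _ (begin
    s + toℕ (index x∈)          ≡⟨ w (index x∈) ⟨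
    f (List.lookup L (index x∈)) ≡⟨ cong f (lookup-index x∈) ⟨
    f x                          ≡⟨ fx≡fy ⟩
    f y                          ≡⟨ cong f (lookup-index y∈) ⟩
    f (List.lookup L (index y∈)) ≡⟨ w (index y∈) ⟩
    s + toℕ (index y∈)          ∎))

length-reverse-toList : ∀ {A : Set} {m} (v : Vec A m) → length (reverse (toList v)) ≡ m
length-reverse-toList v = trans (length-reverse (toList v)) (length-toList v)

∈-toList-lookup : ∀ {A : Set} {m} (v : Vec A m) i → lookup v i ∈ toList v
∈-toList-lookup v i = ∈-toList⁺ (∈-lookupᵥ i v)

position-in : ∀ {A : Set} {m} (v : Vec A m) {x} → x ∈ toList v → ∃[ i ] (lookup v i ≡ x)
position-in v x∈ = VecAny.index (∈-toList⁻ x∈) , sym (VecAnyP.lookup-index (∈-toList⁻ x∈))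

unique-reverse-toList : ∀ {A : Set} {m} (v : Vec A m) →
  (∀ i j → lookup v i ≡ lookup v j → i ≡ j) → Unique (reverse (toList v))
unique-reverse-toList []      _   = []
unique-reverse-toList (x ∷ v) inj = subst Unique (sym (unfold-reverse x (toList v)))
  (Unique.++⁺ (unique-reverse-toList v (λ i j e → Fin.suc-injective (inj (suc i) (suc j) e)))
              (All.[] ∷ []) x-not-later)
  where
  x-not-later : Disjoint (reverse (toList v)) (x List.∷ List.[])
  x-not-later (y∈ , here refl) =
    let (i , vi≡x) = position-in v (reverse⁻ y∈) in Fin.0≢1+n (inj zero (suc i) (sym vi≡x))

unique⇒lookup-injective : ∀ {A : Set} {L : List A} → Unique L →
  ∀ p q → List.lookup L p ≡ List.lookup L q → p ≡ q
unique⇒lookup-injective (_  ∷ _) zero    zero    _  = refl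
unique⇒lookup-injective (x∉ ∷ _) zero    (suc q) eq = ⊥-elim (All.lookup x∉ (∈-lookup q) eq)
unique⇒lookup-injective (x∉ ∷ _) (suc p) zero    eq = ⊥-elim (All.lookup x∉ (∈-lookup p) (sym eq))
unique⇒lookup-injective (_  ∷ u) (suc p) (suc q) eq = cong suc (unique⇒lookup-injective u p q eq)

Separates : ∀ {m k} → (Fin m → ℕ) → Vec (Fin m) k → Vec (Fin m) k → Vec (Fin m) k → Set
Separates {k = k} f c c' c'' =
  ∀ x (a : Fin k) → x ∈ toList c ⊎ x ∈ toList c'' → f x ≡ f (lookup c' a) → x ≡ lookup c' a

module TripletOrder {m k : ℕ} (c c' c'' : Vec (Fin m) k) where
  open DecMem (Fin._≟_ {m}) using (_∈?_)

  outside? : ∀ x → Dec (¬ x ∈ toList c' × ¬ x ∈ toList c'')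
  outside? x = ¬? (x ∈? toList c') ×-dec ¬? (x ∈? toList c'')

  new? : ∀ x → Dec (¬ x ∈ toList c')
  new? x = ¬? (x ∈? toList c')

  front middle back W : List (Fin m)
  front  = filter outside? (reverse (toList c))
  middle = reverse (toList c')
  back   = filter new? (reverse (toList c''))
  W      = tripletOrder c c' c''

  triplet-length : length W ≡ length front + (k + length back)
  triplet-length = trans (length-++ front) (cong (length front +_)
    (trans (length-++ middle) (cong (_+ length back) (length-reverse-toList c'))))

  front-short : ∀ {x} → x ∈ toList c → x ∈ toList c' → length front < k
  front-short x∈c x∈c' = subst (length front <_) (length-reverse-toList c)
    (filter-notAll outside? _ (lose (reverse⁺ x∈c) (λ outside → proj₁ outside x∈c')))

  back-short : ∀ {x} → x ∈ toList c'' → x ∈ toList c' → length back < k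
  back-short x∈c'' x∈c' = subst (length back <_) (length-reverse-toList c'')
    (filter-notAll new? _ (lose (reverse⁺ x∈c'') (λ x∉c' → x∉c' x∈c')))

  triplet-distinct :
    (∀ i j → lookup c i ≡ lookup c j → i ≡ j) → (∀ i j → lookup c' i ≡ lookup c' j → i ≡ j) →
    (∀ i j → lookup c'' i ≡ lookup c'' j → i ≡ j) →
    ∀ (p q : Fin (length W)) → List.lookup W p ≡ List.lookup W q → p ≡ q
  triplet-distinct inj inj' inj'' = unique⇒lookup-injective
    (Unique.++⁺ (Unique.filter⁺ outside? (unique-reverse-toList c inj))
      (Unique.++⁺ (unique-reverse-toList c' inj') (Unique.filter⁺ new? (unique-reverse-toList c'' inj''))
        middle-back)
      front-rest)
    where
    middle-back : Disjoint middle back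
    middle-back (x∈m , x∈b) = proj₂ (∈-filter⁻ new? {xs = reverse (toList c'')} x∈b) (reverse⁻ x∈m)
    front-rest : Disjoint front (middle ++ back)
    front-rest (x∈f , x∈mb) with proj₂ (∈-filter⁻ outside? {xs = reverse (toList c)} x∈f) | ∈-++⁻ middle x∈mb
    ... | x∉c' , _    | inj₁ x∈m = x∉c' (reverse⁻ x∈m)
    ... | _    , x∉c'' | inj₂ x∈b = x∉c'' (reverse⁻ (proj₁ (∈-filter⁻ new? {xs = reverse (toList c'')} x∈b)))

  triplet-covers : ∀ {x} → x ∈ toList c ⊎ x ∈ toList c' ⊎ x ∈ toList c'' → x ∈ W
  triplet-covers {x} occurs with x ∈? toList c'
  ... | yes x∈c' = ∈-++⁺ʳ front (∈-++⁺ˡ (reverse⁺ x∈c'))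
  ... | no  x∉c' with x ∈? toList c''
  ...   | yes x∈c'' = ∈-++⁺ʳ front (∈-++⁺ʳ middle (∈-filter⁺ new? (reverse⁺ x∈c'') x∉c'))
  ...   | no  x∉c'' = ∈-++⁺ˡ (∈-filter⁺ outside? (reverse⁺ x∈c) (x∉c' , x∉c''))
    where
    x∈c : x ∈ toList c
    x∈c = [ (λ x∈c → x∈c) , [ (λ x∈c' → ⊥-elim (x∉c' x∈c')) , (λ x∈c'' → ⊥-elim (x∉c'' x∈c'')) ]′ ]′ occurs

  window-separates : ∀ {f s} → Window f s W → Separates f c c' c''
  window-separates w x a x∈ fx≡ =
    window-injective w (triplet-covers (map₂ inj₂ x∈)) (triplet-covers (inj₂ (inj₁ (∈-toList-lookup c' a)))) fx≡

three-k-minus-two : ∀ k' → 3 * suc k' ∸ 2 ≡ k' + (suc k' + k')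
three-k-minus-two k' = cong (_∸ 2) (solve 1 (λ x → con 3 :* (con 1 :+ x) := con 2 :+ (x :+ ((con 1 :+ x) :+ x))) refl k')
  where
  open import Data.Nat.Solver using (module +-*-Solver)
  open +-*-Solver

placement : ∀ k' a b L → a < suc k' → b < suc k' → L ≡ a + (suc k' + b) →
  1 ≤ suc (k' ∸ a) × suc (k' ∸ a) ≤ k' ∸ a + L × k' ∸ a + L ≤ 3 * suc k' ∸ 2 × suc (k' ∸ a) + a ≡ suc k'
placement k' a b L a<k b<k L≡ = s≤s z≤n , s≤j , j≤t , cong suc (m∸n+n≡m (s≤s⁻¹ a<k))
  where
  open ≤-Reasoning
  s≤j : suc (k' ∸ a) ≤ k' ∸ a + L
  s≤j = begin
    suc (k' ∸ a)  ≡⟨ +-comm 1 (k' ∸ a) ⟩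
    k' ∸ a + 1    ≤⟨ +-monoʳ-≤ (k' ∸ a) (subst (1 ≤_) (sym L≡) (≤-trans (s≤s z≤n) (m≤n+m (suc k' + b) a))) ⟩
    k' ∸ a + L    ∎
  j≤t : k' ∸ a + L ≤ 3 * suc k' ∸ 2
  j≤t = begin
    k' ∸ a + L                   ≡⟨ cong (k' ∸ a +_) L≡ ⟩
    k' ∸ a + (a + (suc k' + b))  ≡⟨ +-assoc (k' ∸ a) a _ ⟨
    k' ∸ a + a + (suc k' + b)    ≡⟨ cong (_+ (suc k' + b)) (m∸n+n≡m (s≤s⁻¹ a<k)) ⟩
    k' + (suc k' + b)            ≤⟨ +-monoʳ-≤ k' (+-monoʳ-≤ (suc k') (s≤s⁻¹ b<k)) ⟩
    k' + (suc k' + k')           ≡⟨ three-k-minus-two k' ⟨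
    3 * suc k' ∸ 2               ∎

window-reverse : ∀ {A : Set} {f : A → ℕ} {s m} (v : Vec A m) → Window f s (reverse (toList v)) →
  ∀ a → f (lookup v a) + suc (toℕ a) ≡ s + m
window-reverse {f = f} {s} {suc m} (x ∷ v) w a =
  let (w-rest , w-last) = window-++ {f = f} {s} (reverse (toList v)) {x List.∷ List.[]} (subst (Window f s) (unfold-reverse x (toList v)) w)
  in  value w-rest w-last a
  where
  open ≡-Reasoning
  value : Window f s (reverse (toList v)) → Window f (s + length (reverse (toList v))) (x List.∷ List.[]) →
    ∀ a → f (lookup (x ∷ v) a) + suc (toℕ a) ≡ s + suc m
  value _ w-last zero = begin
    f x + 1                                   ≡⟨ cong (_+ 1) (w-last zero) ⟩
    s + length (reverse (toList v)) + 0 + 1   ≡⟨ cong (λ t → s + t + 0 + 1) (length-reverse-toList v) ⟩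
    s + m + 0 + 1                             ≡⟨ cong (_+ 1) (+-identityʳ (s + m)) ⟩
    s + m + 1                                 ≡⟨ +-assoc s m 1 ⟩
    s + (m + 1)                               ≡⟨ cong (s +_) (+-comm m 1) ⟩
    s + suc m                                 ∎
  value w-rest _ (suc a) = begin
    f (lookup v a) + suc (suc (toℕ a))        ≡⟨ +-suc _ (suc (toℕ a)) ⟩
    suc (f (lookup v a) + suc (toℕ a))        ≡⟨ cong suc (window-reverse {f = f} {s} v w-rest a) ⟩
    suc (s + m)                               ≡⟨ +-suc s m ⟨
    s + suc m                                 ∎

reverse-window-values : ∀ {A : Set} {f : A → ℕ} {m} (v : Vec A m) → Window f m (reverse (toList v)) →
  ∀ a → f (lookup v a) ≡ 2 * m ∸ suc (toℕ a)
reverse-window-values {f = f} {m} v w a = begin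
  f (lookup v a)                             ≡⟨ m+n∸n≡m _ (suc (toℕ a)) ⟨
  f (lookup v a) + suc (toℕ a) ∸ suc (toℕ a) ≡⟨ cong (_∸ suc (toℕ a)) (window-reverse {f = f} {m} v w a) ⟩
  m + m ∸ suc (toℕ a)                        ≡⟨ cong (λ t → m + t ∸ suc (toℕ a)) (+-identityʳ m) ⟨
  2 * m ∸ suc (toℕ a)                        ∎
  where open ≡-Reasoning

-- If f separates c' from c and c'', then any configuration w with the shifts of
-- c' and the same f-images as c' inherits freshness from c' and so is reached
-- by the same transitions.
reroute : ∀ {G k ℓ r} {c c' c'' w : Vec (Fin (n G)) k} (f : Fin (n G) → ℕ) → ℓ < k → r < k →
  IsConf G k c → IsConf G k c'' → IsConf G k w →
  Trans G k ℓ c c' → Trans G k r c' c'' → Separates f c c' c'' →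
  (∀ a → f (lookup w a) ≡ f (lookup c' a)) → Shift ℓ c w → Shift r w c'' →
  Trans G k ℓ c w × Trans G k r w c''
reroute {ℓ = ℓ} {r} {c} {c'} {c''} {w} f ℓ<k r<k cc cc'' cw T₁ T₂ sep fw≡ shw shw'' =
  shift-fresh⇒transition ℓ<k cc cw shw fresh-cw , shift-fresh⇒transition r<k cw cc'' shw'' fresh-wc''
  where
  -- w_a = c_b forces c'_a = c_b.
  fresh-cw : Fresh ℓ c w
  fresh-cw a b a<ℓ room w≡c = proj₂ (transition⇒shift-fresh T₁) a b a<ℓ room
    (sym (sep (lookup c b) a (inj₁ (∈-toList-lookup c b)) (trans (cong f (sym w≡c)) (fw≡ a))))
  -- c''_a = w_b forces c''_a = c'_b.
  fresh-wc'' : Fresh r w c''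
  fresh-wc'' a b a<r room c''≡w = proj₂ (transition⇒shift-fresh T₂) a b a<r room
    (sep (lookup c'' a) b (inj₂ (∈-toList-lookup c'' a)) (trans (cong f c''≡w) (fw≡ b)))

lemma3p8 : (G : Graph) (k ℓ r : ℕ) → ℓ < k → r < k →
    (c c' c'' : Vec (Fin (n G)) k) →
    IsConf G k c → IsConf G k c' → IsConf G k c'' →
    Trans G k ℓ c c' → Trans G k r c' c'' →
    (𝒢 : List (Fin (n G) → ℕ)) → IsPermuter G (3 * k ∸ 2) 𝒢 →
    ∃[ f ] (f ∈ 𝒢 ×
      (∃[ i ] ∃[ j ] (1 ≤ i × i ≤ j × j ≤ 3 * k ∸ 2 ×
         suc j ≡ i + length (tripletOrder c c' c'') ×
         (∀ (p : Fin (length (tripletOrder c c' c''))) →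
            f (List.lookup (tripletOrder c c' c'') p) ≡ i + toℕ p))) ×
      (∀ (a : Fin k) → f (lookup c' a) ≡ 2 * k ∸ suc (toℕ a)) ×
      (∀ (p q : Fin (length (tripletOrder c c' c''))) → p ≢ q →
         f (List.lookup (tripletOrder c c' c'') p) ≢ f (List.lookup (tripletOrder c c' c'') q)) ×
      (∀ (w : Vec (Fin (n G)) k) → IsConf G k w →
         (∀ (a : Fin k) → toℕ a ≡ 0 → lookup w a ≡ lookup c' a) →
         (∀ (a : Fin k) → suc (toℕ a) ≡ k → lookup w a ≡ lookup c' a) →
         (∀ (a : Fin k) → f (lookup w a) ≡ 2 * k ∸ suc (toℕ a)) →
         (∀ (a b : Fin k) → toℕ a ≡ toℕ b + ℓ → lookup w a ≡ lookup c b) →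
         (∀ (a b : Fin k) → toℕ a ≡ toℕ b + r → lookup c'' a ≡ lookup w b) →
         Trans G k ℓ c w × Trans G k r w c''))
lemma3p8 G zero     ℓ r () _ c c' c'' _ _ _ _ _ _ _
lemma3p8 G (suc k') ℓ r ℓ<k r<k c c' c'' cc cc' cc'' T₁ T₂ 𝒢 (_ , onto) =
  f , proj₁ (proj₂ chosen) , (s , j , 1≤s , s≤j , j≤t , refl , win) , c'-values ,
  window-distinct {f = f} {s} {W} win ,
  λ w cw _ _ fw shw shw'' →
    reroute f ℓ<k r<k cc cc'' cw T₁ T₂ (window-separates win) (λ a → trans (fw a) (sym (c'-values a))) shw shw''
  where
  open TripletOrder c c' c''
  -- The first vertex of c survives into c', that of c' into c'': front and back are short.
  front<k : length front < suc k'
  front<k = front-short (∈-toList-lookup c zero) (first-survives {c = c} {c'} ℓ<k (proj₁ (transition⇒shift-fresh T₁)))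
  back<k : length back < suc k'
  back<k = back-short (first-survives {c = c'} {c''} r<k (proj₁ (transition⇒shift-fresh T₂))) (∈-toList-lookup c' zero)
  s j : ℕ
  s = suc (k' ∸ length front)
  j = k' ∸ length front + length W
  bounds : 1 ≤ s × s ≤ j × j ≤ 3 * suc k' ∸ 2 × s + length front ≡ suc k'
  bounds = placement k' (length front) (length back) (length W) front<k back<k triplet-length
  1≤s : 1 ≤ s
  1≤s = proj₁ bounds
  s≤j : s ≤ j
  s≤j = proj₁ (proj₂ bounds)
  j≤t : j ≤ 3 * suc k' ∸ 2
  j≤t = proj₁ (proj₂ (proj₂ bounds))
  chosen : ∃[ g ] (g ∈ 𝒢 × Window g s W)
  chosen = onto W (triplet-distinct (proj₁ cc) (proj₁ cc') (proj₁ cc'')) s j 1≤s s≤j j≤t refl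
  f : Fin (n G) → ℕ
  f = proj₁ chosen
  win : Window f s W
  win = proj₂ (proj₂ chosen)
  middle-window : Window f (suc k') middle
  middle-window = subst (λ t → Window f t middle) (proj₂ (proj₂ (proj₂ bounds)))
    (proj₁ (window-++ {f = f} {s + length front} middle {back} (proj₂ (window-++ {f = f} {s} front {middle ++ back} win))))
  c'-values : ∀ a → f (lookup c' a) ≡ 2 * suc k' ∸ suc (toℕ a)
  c'-values = reverse-window-values {f = f} c' middle-window
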